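{- Let $l$ be a complete lattice which is a de Morgan algebra with a residual implication, let $AP$ be a finite set and $\varphi$ an mv-proposition formula over $AP$. Then the invariant $\mathrm{inv}(\varphi):(2^{AP})^{\omega}\to l$, $\mathrm{inv}(\varphi)(A_0A_1A_2\cdots)=\bigwedge_{i\ge0}\varphi(A_i)$, is a safety property.
   Context: $l$ is a complete distributive lattice satisfying $x\wedge\bigvee_i a_i=\bigvee_i(x\wedge a_i)$, with an order-reversing involution $\neg$ and implication $a\to b=\bigvee\{c:a\wedge c\le b\}$. mv-proposition formulas are generated by $\varphi::=A\mid r\mid \varphi_1\vee\varphi_2\mid\varphi_1\to\varphi_2\mid\neg\varphi$ with $A\in AP$, $r\in l$ (and $\varphi_1\wedge\varphi_2:=\neg(\neg\varphi_1\vee\neg\varphi_2)$). For $\Phi\subseteq AP$, $\varphi(\Phi)\in l$ is the value of $\varphi$ under the valuation $A\mapsto1$ if $A\in\Phi$, $A\mapsto 0$ otherwise, constants $r\mapsto r$, and connectives interpreted by $\vee,\to,\neg$ of $l$. $\mathrm{Pref}(\sigma)$ is the set of finite prefixes of $\sigma$; $\mathrm{GPref}(P)(\theta)=\bigvee\{P(\theta\tau):\tau\in(2^{AP})^{\omega}\}$; $P$ is a safety property if $\bigwedge\{\mathrm{GPref}(P)(\theta):\theta\in\mathrm{Pref}(\sigma)\}\le P(\sigma)$ for all $\sigma$. -}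

module Defs where

open import Data.Nat using (ℕ; zero; suc; _∸_; _<?_)
open import Data.Fin using (Fin; toℕ)
open import Data.Bool using (Bool; true; false; if_then_else_)
open import Data.Vec using (Vec; lookup)
open import Data.List using (List; length; []; _∷_)
import Data.List as List
open import Data.Empty using (⊥; ⊥-elim)
open import Data.Product using (Σ; proj₁; _,_)
open import Relation.Binary.PropositionalEquality using (_≡_)
open import Relation.Binary.Structures using (IsPartialOrder)

record MVLattice : Set₁ where
  infixr 6 _∨_
  infixr 7 _∧_
  field
    Carrier        : Set
    _≤_            : Carrier → Carrier → Set
    isPartialOrder : IsPartialOrder _≡_ _≤_
    _∨_   : Carrier → Carrier → Carrier
    ∨-ubˡ : ∀ a b → a ≤ (a ∨ b)
    ∨-ubʳ : ∀ a b → b ≤ (a ∨ b)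
    ∨-lub : ∀ a b c → a ≤ c → b ≤ c → (a ∨ b) ≤ c
    _∧_   : Carrier → Carrier → Carrier
    ∧-lbˡ : ∀ a b → (a ∧ b) ≤ a
    ∧-lbʳ : ∀ a b → (a ∧ b) ≤ b
    ∧-glb : ∀ a b c → c ≤ a → c ≤ b → c ≤ (a ∧ b)
    ⋁       : {I : Set} → (I → Carrier) → Carrier
    ⋁-ub    : ∀ {I : Set} (f : I → Carrier) (i : I) → f i ≤ ⋁ f
    ⋁-least : ∀ {I : Set} (f : I → Carrier) (x : Carrier) → (∀ i → f i ≤ x) → ⋁ f ≤ x
    ⋀          : {I : Set} → (I → Carrier) → Carrier
    ⋀-lb       : ∀ {I : Set} (f : I → Carrier) (i : I) → ⋀ f ≤ f i
    ⋀-greatest : ∀ {I : Set} (f : I → Carrier) (x : Carrier) → (∀ i → x ≤ f i) → x ≤ ⋀ f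
    ∧-⋁-distrib : ∀ {I : Set} (x : Carrier) (f : I → Carrier) → (x ∧ ⋁ f) ≡ ⋁ (λ i → x ∧ f i)
    ¬_         : Carrier → Carrier
    ¬-antitone : ∀ {a b} → a ≤ b → (¬ b) ≤ (¬ a)
    ¬-involutive : ∀ a → (¬ (¬ a)) ≡ a

  𝟘 : Carrier
  𝟘 = ⋁ {⊥} ⊥-elim

  𝟙 : Carrier
  𝟙 = ⋀ {⊥} ⊥-elim

  _⇒_ : Carrier → Carrier → Carrier
  a ⇒ b = ⋁ {Σ Carrier (λ c → (a ∧ c) ≤ b)} proj₁

-- AP = Fin n (a finite set of atomic propositions); 2^AP = Vec Bool n.
Letter : ℕ → Set
Letter n = Vec Bool n

module _ (L : MVLattice) where
  open MVLattice L

  data Formula (n : ℕ) : Set where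
    atom  : Fin n → Formula n
    const : Carrier → Formula n
    _∨ᶠ_  : Formula n → Formula n → Formula n
    _⇒ᶠ_  : Formula n → Formula n → Formula n
    ¬ᶠ_   : Formula n → Formula n

  ⟦_⟧ : ∀ {n} → Formula n → Letter n → Carrier
  ⟦ atom A ⟧ Φ = if lookup Φ A then 𝟙 else 𝟘
  ⟦ const r ⟧ Φ = r
  ⟦ φ ∨ᶠ ψ ⟧ Φ = ⟦ φ ⟧ Φ ∨ ⟦ ψ ⟧ Φ
  ⟦ φ ⇒ᶠ ψ ⟧ Φ = ⟦ φ ⟧ Φ ⇒ ⟦ ψ ⟧ Φ
  ⟦ ¬ᶠ φ ⟧ Φ = ¬ (⟦ φ ⟧ Φ)

Word : ℕ → Set
Word n = ℕ → Letter n

FinWord : ℕ → Set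
FinWord n = List (Letter n)

_++ω_ : ∀ {n} → FinWord n → Word n → Word n
([] ++ω τ) i = τ i
((a ∷ θ) ++ω τ) zero = a
((a ∷ θ) ++ω τ) (suc i) = (θ ++ω τ) i

IsPrefix : ∀ {n} → FinWord n → Word n → Set
IsPrefix θ σ = ∀ (i : Fin (length θ)) → List.lookup θ i ≡ σ (toℕ i)

Pref : ∀ {n} → Word n → Set
Pref {n} σ = Σ (FinWord n) (λ θ → IsPrefix θ σ)

module _ (L : MVLattice) where
  open MVLattice L

  Property : ℕ → Set
  Property n = Word n → Carrier

  GPref : ∀ {n} → Property n → FinWord n → Carrier
  GPref P θ = ⋁ (λ τ → P (θ ++ω τ))

  IsSafety : ∀ {n} → Property n → Set
  IsSafety P = ∀ σ → ⋀ {Pref σ} (λ θ → GPref P (proj₁ θ)) ≤ P σ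

  inv : ∀ {n} → Formula L n → Property n
  inv φ σ = ⋀ {ℕ} (λ i → ⟦ L ⟧ φ (σ i))

-- The value of inv(φ) at σ only depends on φ(σᵢ) for each i. Fix i: the prefix
-- θ = σ₀…σᵢ fixes the letter at position i of every continuation θτ, so
-- GPref(inv φ)(θ) = ⋁_τ inv(φ)(θτ) ≤ φ(σᵢ). Meeting over i gives the claim.
module Submission where

open import Data.Nat using (ℕ; zero; suc)
open import Data.Fin using (Fin)
open import Data.List using ([]; _∷_)
open import Data.Product using (_,_)
open import Relation.Binary.PropositionalEquality using (_≡_; refl; subst)
open import Relation.Binary.Structures using (IsPartialOrder)
open import Defs

tail : ∀ {n} → Word n → Word n
tail σ i = σ (suc i)

prefix : ∀ {n} → ℕ → Word n → FinWord n
prefix zero    σ = []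
prefix (suc k) σ = σ 0 ∷ prefix k (tail σ)

prefix-isPrefix : ∀ {n} k (σ : Word n) → IsPrefix (prefix k σ) σ
prefix-isPrefix (suc k) σ Fin.zero    = refl
prefix-isPrefix (suc k) σ (Fin.suc j) = prefix-isPrefix k (tail σ) j

prefix-++ω-last : ∀ {n} i (σ τ : Word n) → (prefix (suc i) σ ++ω τ) i ≡ σ i
prefix-++ω-last zero    σ τ = refl
prefix-++ω-last (suc i) σ τ = prefix-++ω-last i (tail σ) τ

module _ (L : MVLattice) where
  open MVLattice L
  open IsPartialOrder isPartialOrder using (trans)

  pointwiseInvariant : ∀ {n} → (Letter n → Carrier) → Property L n
  pointwiseInvariant f σ = ⋀ (λ i → f (σ i))

  GPref-pointwiseInvariant-prefix≤ : ∀ {n} (f : Letter n → Carrier) (σ : Word n) i →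
    GPref L (pointwiseInvariant f) (prefix (suc i) σ) ≤ f (σ i)
  GPref-pointwiseInvariant-prefix≤ f σ i = ⋁-least _ _ λ τ →
    subst (λ a → pointwiseInvariant f (prefix (suc i) σ ++ω τ) ≤ f a)
          (prefix-++ω-last i σ τ)
          (⋀-lb _ i)

  pointwiseInvariant-isSafety : ∀ {n} (f : Letter n → Carrier) →
    IsSafety L (pointwiseInvariant f)
  pointwiseInvariant-isSafety f σ = ⋀-greatest _ _ λ i →
    trans (⋀-lb _ (prefix (suc i) σ , prefix-isPrefix (suc i) σ))
          (GPref-pointwiseInvariant-prefix≤ f σ i)

corollary1 : (L : MVLattice) (n : ℕ) (φ : Formula L n) → IsSafety L (inv L φ)
corollary1 L n φ = pointwiseInvariant-isSafety L (⟦ L ⟧ φ)
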